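{- Let $\mathsf{TA}$ be a threshold automaton whose set of guards has $k$ elements. Then every (finite) path of $\mathsf{TA}$ is the concatenation of at most $k+1$ steady paths.
   Context: An environment is $\mathit{Env}=(\Pi,RC,N)$: $\Pi$ a finite set of parameters over $\mathbb N_0$, $RC\subseteq\mathbb N_0^\Pi$ integer-linear-definable, $N\colon RC\to\mathbb N_0$ linear. A threshold automaton over $\mathit{Env}$ is $\mathsf{TA}=(\mathcal L,\mathcal I,\Gamma,\mathcal R)$ with locations $\mathcal L$, initial locations $\mathcal I$, shared variables $\Gamma$ over $\mathbb N_0$, and rules $r=(r.\mathit{from},r.\mathit{to},r.\varphi,r.\vec u)$, where $r.\varphi$ is a conjunction of threshold guards and $r.\vec u\in\{0,1\}^\Gamma$. A threshold guard is a rise guard $x\ge a_0+\sum_ia_ip_i$ or a fall guard $x<a_0+\sum_ia_ip_i$ ($x\in\Gamma$, $p_i\in\Pi$, $a_i\in\mathbb Q$); the guards of $\mathsf{TA}$ are the threshold guards occurring in its rules. A configuration $\sigma=(\sigma.\kappa,\sigma.\vec g,\sigma.\vec p)$ has $\sigma.\kappa\colon\mathcal L\to\mathbb N_0$, $\sigma.\vec g\in\mathbb N_0^\Gamma$, $\sigma.\vec p\in RC$, $\sum_\ell\sigma.\kappa(\ell)=N(\sigma.\vec p)$. $\sigma$ enables $r$ if $\sigma.\kappa(r.\mathit{from})>0$ and $(\sigma.\vec g,\sigma.\vec p)$ satisfies $r.\varphi$; then $r(\sigma)$ keeps parameters, has shared values $\sigma.\vec g+r.\vec u$, and moves one process from $r.\mathit{from}$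 to $r.\mathit{to}$. A path is an alternating sequence $\sigma_0,r_1,\sigma_1,\dots,r_m,\sigma_m$ with $\sigma_{i-1}$ enabling $r_i$ and $\sigma_i=r_i(\sigma_{i-1})$. The context $\omega(\sigma)$ of a configuration is the set of rise guards of $\mathsf{TA}$ that are true in $\sigma$ together with the fall guards of $\mathsf{TA}$ that are false in $\sigma$. A path is steady if all configurations on it have the same context. A path is the concatenation of steady paths $P_1,\dots,P_j$ if its configuration sequence splits into $j$ consecutive blocks forming the steady paths $P_1,\dots,P_j$, the last configuration of each $P_i$ being connected to the first configuration of $P_{i+1}$ by a single rule of the path. -}

module Defs where

open import Data.Nat as ℕ using (ℕ; zero; suc; _∸_)
open import Data.Integer as ℤ using (ℤ; +_)
open import Data.Rational as ℚ using (ℚ)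
open import Data.Fin using (Fin; zero; suc)
open import Data.Fin.Properties using () renaming (_≟_ to _≟ᶠ_)
open import Data.Vec using (Vec; []; _∷_; lookup)
open import Data.List using (List; []; _∷_; concat; length)
open import Data.List.Membership.Propositional using (_∈_)
open import Data.List.Relation.Unary.All using (All)
open import Data.List.Relation.Unary.Any using (Any)
open import Data.Product using (_×_; Σ; ∃)
open import Data.Sum using (_⊎_)
open import Data.Bool using (Bool)
open import Data.Empty using (⊥)
open import Data.Unit using (⊤)
open import Relation.Nullary using (¬_; yes; no)
open import Relation.Binary.PropositionalEquality using (_≡_)
open import Function.Bundles using (_⇔_)

sumℤ : ∀ {n} → Vec ℤ n → (Fin n → ℕ) → ℤ
sumℤ []       p = + 0
sumℤ (c ∷ cs) p = c ℤ.* (+ p zero) ℤ.+ sumℤ cs (λ i → p (suc i))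

sumℚ : ∀ {n} → Vec ℚ n → (Fin n → ℕ) → ℚ
sumℚ []       p = ℚ.0ℚ
sumℚ (a ∷ as) p = a ℚ.* (+ p zero ℚ./ 1) ℚ.+ sumℚ as (λ i → p (suc i))

sumFin : ∀ n → (Fin n → ℕ) → ℕ
sumFin zero    f = 0
sumFin (suc n) f = f zero ℕ.+ sumFin n (λ i → f (suc i))

record LinConstraint (np : ℕ) : Set where
  field
    const  : ℤ
    coeffs : Vec ℤ np

SatLin : ∀ {np} → LinConstraint np → (Fin np → ℕ) → Set
SatLin c p = + 0 ℤ.≤ LinConstraint.const c ℤ.+ sumℤ (LinConstraint.coeffs c) p

record Env : Set where
  field
    np       : ℕ                    -- Π = Fin np
    rcCons   : List (LinConstraint np)
    nConst   : ℤ
    nCoeffs  : Vec ℤ np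

  Params : Set
  Params = Fin np → ℕ

  RC : Params → Set
  RC p = All (λ c → SatLin c p) rcCons

  Nℤ : Params → ℤ
  Nℤ p = nConst ℤ.+ sumℤ nCoeffs p

  field
    N-nonneg : ∀ p → RC p → + 0 ℤ.≤ Nℤ p

data GuardKind : Set where
  rise fall : GuardKind

-- rise:  x ≥ a₀ + Σ a_i p_i      fall:  x < a₀ + Σ a_i p_i
record Guard (nΓ np : ℕ) : Set where
  constructor guard
  field
    kind   : GuardKind
    var    : Fin nΓ
    a₀     : ℚ
    coeffs : Vec ℚ np

record Rule (nL nΓ np : ℕ) : Set where
  field
    from   : Fin nL
    to     : Fin nL
    φ      : List (Guard nΓ np)
    u      : Fin nΓ → Bool         -- update vector in {0,1}^Γ

record TA (E : Env) : Set where
  field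
    nL     : ℕ                       -- 𝓛 = Fin nL
    init   : Fin nL → Bool           -- 𝓘 ⊆ 𝓛
    nΓ     : ℕ                       -- Γ = Fin nΓ
    rules  : List (Rule nL nΓ (Env.np E))

IsGuardOf : ∀ {E} (A : TA E) → Guard (TA.nΓ A) (Env.np E) → Set
IsGuardOf A g = Any (λ r → g ∈ Rule.φ r) (TA.rules A)

module _ {E : Env} (A : TA E) where
  open Env E
  open TA A

  record Config : Set where
    constructor config
    field
      κ : Fin nL → ℕ
      g : Fin nΓ → ℕ
      p : Params

  IsConfig : Config → Set
  IsConfig σ = RC (Config.p σ) × (+ sumFin nL (Config.κ σ) ≡ Nℤ (Config.p σ))

  GuardHolds : Guard nΓ np → Config → Set
  GuardHolds (guard rise x a₀ as) σ =
    (+ Config.g σ x ℚ./ 1) ℚ.≥ a₀ ℚ.+ sumℚ as (Config.p σ)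
  GuardHolds (guard fall x a₀ as) σ =
    (+ Config.g σ x ℚ./ 1) ℚ.< a₀ ℚ.+ sumℚ as (Config.p σ)

  Enables : Config → Rule nL nΓ np → Set
  Enables σ r = (0 ℕ.< Config.κ σ (Rule.from r)) × All (λ g → GuardHolds g σ) (Rule.φ r)

  private
    ind : ∀ {m} → Fin m → Fin m → ℕ
    ind i j with i ≟ᶠ j
    ... | yes _ = 1
    ... | no  _ = 0

    b2n : Bool → ℕ
    b2n Bool.false = 0
    b2n Bool.true  = 1

  apply : Rule nL nΓ np → Config → Config
  apply r σ = config
    (λ ℓ → (Config.κ σ ℓ ∸ ind (Rule.from r) ℓ) ℕ.+ ind (Rule.to r) ℓ)
    (λ x → Config.g σ x ℕ.+ b2n (Rule.u r x))
    (Config.p σ)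

  -- A path σ₀, r₁, σ₁, …, r_m, σ_m is determined by σ₀ and r₁ … r_m;
  -- its configuration sequence:
  configs : Config → List (Rule nL nΓ np) → List Config
  configs σ []       = σ ∷ []
  configs σ (r ∷ rs) = σ ∷ configs (apply r σ) rs

  IsPath : Config → List (Rule nL nΓ np) → Set
  IsPath σ []       = IsConfig σ
  IsPath σ (r ∷ rs) = IsConfig σ × r ∈ rules × Enables σ r × IsPath (apply r σ) rs

  InContext : Guard nΓ np → Config → Set
  InContext g σ with Guard.kind g
  ... | rise = GuardHolds g σ
  ... | fall = ¬ GuardHolds g σ

  SameContext : Config → Config → Set
  SameContext σ σ' = ∀ g → IsGuardOf A g → (InContext g σ ⇔ InContext g σ')

  Steady : List Config → Set
  Steady cs = All (λ σ → All (λ σ' → SameContext σ σ') cs) cs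

  NonEmpty : List Config → Set
  NonEmpty []      = ⊥
  NonEmpty (_ ∷ _) = ⊤

  -- the path (σ₀, rs) is the concatenation of the steady paths whose
  -- configuration sequences are the consecutive nonempty blocks `bs`
  -- (consecutive blocks are joined by the corresponding rule of the path)
  IsSteadyDecomposition : Config → List (Rule nL nΓ np) → List (List Config) → Set
  IsSteadyDecomposition σ rs bs =
    (concat bs ≡ configs σ rs) × All NonEmpty bs × All Steady bs

-- Firing a rule only increases shared variables and never changes parameters, so
-- along any path rise guards can only become true and fall guards only false:
-- the context grows monotonically. Hence the number of guards in the context is a
-- non-decreasing measure bounded by k, the context is constant on every maximal
-- run of configurations on which this number is constant, and there are at most
-- k + 1 such runs.
module Submission where

open import Defs
open import Data.Nat using (ℕ; suc; _≤_; _+_; _≟_; z≤n; s≤s)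
open import Data.Nat.Properties
  using (≤-trans; m≤m+n; ≤∧≢⇒<; +-suc; +-monoʳ-≤; module ≤-Reasoning)
open import Data.Nat.Coprimality using (1-coprimeTo) renaming (sym to coprime-sym)
open import Data.Integer using (+_; +≤+)
open import Data.Integer.Properties using (*-monoʳ-≤-nonNeg)
open import Data.Rational as ℚ using (mkℚ)
import Data.Rational.Properties as ℚ
open import Data.List using (List; []; _∷_; length; concat; filter)
open import Data.List.Properties using (length-filter)
open import Data.List.Membership.Propositional using (_∈_)
open import Data.List.Membership.Propositional.Properties using (∈-filter⁺; ∈-filter⁻)
open import Data.List.Relation.Unary.All as All using (All; []; _∷_)
open import Data.List.Relation.Unary.Linked as Linked using (Linked; []; [-]; _∷_)
open import Data.List.Relation.Unary.Linked.Properties using (Linked⇒All)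
open import Data.List.Relation.Unary.Unique.Propositional using (Unique)
open import Data.List.Relation.Binary.Sublist.Propositional as Sublist using (⊆-refl)
open import Data.List.Relation.Binary.Sublist.Propositional.Properties
  using (filter⁺; length-mono-≤; to-≋)
open import Data.List.Relation.Binary.Equality.Propositional using (≋⇒≡)
open import Data.Product using (Σ; _×_; _,_; proj₂; map₁)
open import Data.Unit using (tt)
open import Function.Base using (_on_)
open import Function.Bundles using (_⇔_; mk⇔; Equivalence)
open import Function.Properties.Equivalence using (⇔-isEquivalence)
open import Level using (Level; 0ℓ)
open import Relation.Binary.Core using (Rel)
open import Relation.Binary.Definitions using (Decidable)
open import Relation.Binary.Structures using (IsEquivalence)
open import Relation.Binary.Construct.Intersection using (_∩_)
open import Relation.Binary.PropositionalEquality using (_≡_; _≢_; refl; sym; cong; subst)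
open import Relation.Nullary using (Dec; yes; no; ¬?)
open import Relation.Unary using (Pred; _⊆_) renaming (Decidable to Decidable₁)

private
  variable
    a p r : Level
    A : Set a

module _ {P Q : Pred A p} (P? : Decidable₁ P) (Q? : Decidable₁ Q) (P⊆Q : P ⊆ Q) where

  filter-mono : ∀ xs → filter P? xs Sublist.⊆ filter Q? xs
  filter-mono xs = filter⁺ P? Q? {as = xs} {bs = xs} (λ { refl → P⊆Q }) ⊆-refl

  length-filter-mono : ∀ xs → length (filter P? xs) ≤ length (filter Q? xs)
  length-filter-mono xs = length-mono-≤ {as = filter P? xs} (filter-mono xs)

  length-filter-≡⇒⊇ : ∀ {xs} → length (filter P? xs) ≡ length (filter Q? xs)
                    → ∀ {x} → x ∈ xs → Q x → P x
  length-filter-≡⇒⊇ {xs} eq x∈xs qx =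
    proj₂ (∈-filter⁻ P? {xs = xs} (subst (_ ∈_) (sym filters≡) (∈-filter⁺ Q? x∈xs qx)))
    where
    filters≡ : filter P? xs ≡ filter Q? xs
    filters≡ = ≋⇒≡ (to-≋ {as = filter P? xs} eq (filter-mono xs))

Linked⇒All² : {_≈_ : Rel A r} → IsEquivalence _≈_
            → ∀ {xs} → Linked _≈_ xs → All (λ x → All (x ≈_) xs) xs
Linked⇒All² isEq []              = []
Linked⇒All² {_≈_ = _≈_} isEq {x ∷ xs} linked =
  All.map (λ x≈y → All.map (λ x≈z → ≈.trans (≈.sym x≈y) x≈z) x≈all) x≈all
  where
  module ≈ = IsEquivalence isEq
  x≈all : All (x ≈_) (x ∷ xs)
  x≈all = Linked⇒All ≈.trans ≈.refl linked

module Runs {_~_ : Rel A r} (_~?_ : Decidable _~_) where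

  closeRun : A → List A × List (List A) → List (List A)
  closeRun x (run , later) = (x ∷ run) ∷ later

  -- the rest of the run that x begins, and the runs after it
  runsFrom : A → List A → List A × List (List A)
  runsFrom x []       = [] , []
  runsFrom x (y ∷ ys) with x ~? y
  ... | yes _ = map₁ (y ∷_) (runsFrom y ys)
  ... | no  _ = [] , closeRun y (runsFrom y ys)

  runs : List A → List (List A)
  runs []       = []
  runs (x ∷ xs) = closeRun x (runsFrom x xs)

  concat-runs : ∀ xs → concat (runs xs) ≡ xs
  concat-runs []       = refl
  concat-runs (x ∷ xs) = concat-runs-∷ x xs
    where
    concat-runs-∷ : ∀ x ys → concat (runs (x ∷ ys)) ≡ x ∷ ys
    concat-runs-∷ x []       = refl
    concat-runs-∷ x (y ∷ ys) with x ~? y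
    ... | yes _ = cong (x ∷_) (concat-runs-∷ y ys)
    ... | no  _ = cong (x ∷_) (concat-runs-∷ y ys)

  runs-≢[] : ∀ xs → All (_≢ []) (runs xs)
  runs-≢[] []       = []
  runs-≢[] (x ∷ xs) = runs-∷-≢[] x xs
    where
    runs-∷-≢[] : ∀ x ys → All (_≢ []) (runs (x ∷ ys))
    runs-∷-≢[] x []       = (λ ()) ∷ []
    runs-∷-≢[] x (y ∷ ys) with x ~? y | runs-∷-≢[] y ys
    ... | yes _ | _ ∷ later = (λ ()) ∷ later
    ... | no  _ | later     = (λ ()) ∷ later

  runs-Linked : ∀ {R : Rel A p} {xs} → Linked R xs → All (Linked (R ∩ _~_)) (runs xs)
  runs-Linked {xs = []}     []     = []
  runs-Linked {xs = x ∷ xs} linked = runs-∷-Linked x xs linked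
    where
    runs-∷-Linked : ∀ {R : Rel A p} x ys → Linked R (x ∷ ys)
                  → All (Linked (R ∩ _~_)) (runs (x ∷ ys))
    runs-∷-Linked x []       [-]            = [-] ∷ []
    runs-∷-Linked x (y ∷ ys) (Rxy ∷ linked) with x ~? y | runs-∷-Linked y ys linked
    ... | yes x~y | run ∷ later = ((Rxy , x~y) ∷ run) ∷ later
    ... | no  _   | later       = [-] ∷ later

module RunsOf (f : A → ℕ) where
  open Runs {_~_ = _≡_ on f} (λ x y → f x ≟ f y) public

  length-runs≤ : ∀ {K xs} → Linked (_≤_ on f) xs → All (λ x → f x ≤ K) xs
               → length (runs xs) ≤ suc K
  length-runs≤ {xs = []}     []     []      = z≤n
  length-runs≤ {xs = x ∷ xs} linked bounded =
    ≤-trans (m≤m+n _ (f x)) (length-runs-∷ x xs linked bounded)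
    where
    length-runs-∷ : ∀ {K} x ys → Linked (_≤_ on f) (x ∷ ys) → All (λ x → f x ≤ K) (x ∷ ys)
                  → length (runs (x ∷ ys)) + f x ≤ suc K
    length-runs-∷ x []       [-]              (fx≤K ∷ []) = s≤s fx≤K
    length-runs-∷ {K} x (y ∷ ys) (fx≤fy ∷ linked) (_ ∷ bounded)
      with f x ≟ f y | length-runs-∷ y ys linked bounded
    ... | yes fx≡fy | ih = subst (λ n → length (runs (y ∷ ys)) + n ≤ suc K) (sym fx≡fy) ih
    ... | no  fx≢fy | ih = begin
      suc (L + f x) ≡⟨ sym (+-suc L (f x)) ⟩
      L + suc (f x) ≤⟨ +-monoʳ-≤ L (≤∧≢⇒< fx≤fy fx≢fy) ⟩
      L + f y       ≤⟨ ih ⟩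
      suc K           ∎
      where
      open ≤-Reasoning
      L = length (runs (y ∷ ys))

+/1≡mkℚ : ∀ n → + n ℚ./ 1 ≡ mkℚ (+ n) 0 (coprime-sym (1-coprimeTo n))
+/1≡mkℚ n = ℚ.normalize-coprime (coprime-sym (1-coprimeTo n))

+/1-mono-≤ : ∀ {m n} → m ≤ n → + m ℚ./ 1 ℚ.≤ + n ℚ./ 1
+/1-mono-≤ {m} {n} m≤n rewrite +/1≡mkℚ m | +/1≡mkℚ n =
  ℚ.*≤* (*-monoʳ-≤-nonNeg (+ 1) (+≤+ m≤n))

module _ {E : Env} (A : TA E) where
  open Env E using (np)
  open TA A using (nΓ)

  _≼_ : Rel (Config A) 0ℓ
  σ ≼ τ = Config.p σ ≡ Config.p τ × (∀ x → Config.g σ x ≤ Config.g τ x)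

  ≼-apply : ∀ r σ → σ ≼ apply A r σ
  ≼-apply r σ = refl , λ x → m≤m+n _ _

  configs-≼-Linked : ∀ σ rs → Linked _≼_ (configs A σ rs)
  configs-≼-Linked σ []            = [-]
  configs-≼-Linked σ (r ∷ [])      = ≼-apply r σ ∷ [-]
  configs-≼-Linked σ (r ∷ r′ ∷ rs) = ≼-apply r σ ∷ configs-≼-Linked (apply A r σ) (r′ ∷ rs)

  InContext-mono : ∀ {σ τ} → σ ≼ τ → ∀ g → InContext A g σ → InContext A g τ
  InContext-mono {config _ _ p} {config _ _ .p} (refl , g≤g′) (guard rise x _ _) holds =
    ℚ.≤-trans holds (+/1-mono-≤ (g≤g′ x))
  InContext-mono {config _ _ p} {config _ _ .p} (refl , g≤g′) (guard fall x _ _) fails holds′ =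
    fails (ℚ.≤-<-trans (+/1-mono-≤ (g≤g′ x)) holds′)

  InContext? : ∀ σ g → Dec (InContext A g σ)
  InContext? σ (guard rise _ _ _) = _ ℚ.≤? _
  InContext? σ (guard fall _ _ _) = ¬? (_ ℚ.<? _)

  SameContext-isEquivalence : IsEquivalence (SameContext A)
  SameContext-isEquivalence = record
    { refl  = λ g _ → ⇔.refl
    ; sym   = λ σ~τ g isGuard → ⇔.sym (σ~τ g isGuard)
    ; trans = λ σ~τ τ~υ g isGuard → ⇔.trans (σ~τ g isGuard) (τ~υ g isGuard)
    }
    where module ⇔ = IsEquivalence ⇔-isEquivalence

  ≢[]⇒NonEmpty : ∀ {σs} → σs ≢ [] → NonEmpty A σs
  ≢[]⇒NonEmpty {[]}    σs≢[] = σs≢[] refl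
  ≢[]⇒NonEmpty {_ ∷ _} _     = tt

  module _ (guards : List (Guard nΓ np)) where

    contextSize : Config A → ℕ
    contextSize σ = length (filter (InContext? σ) guards)

    contextSize≤ : ∀ σ → contextSize σ ≤ length guards
    contextSize≤ σ = length-filter (InContext? σ) guards

    contextSize-mono : ∀ {σ τ} → σ ≼ τ → contextSize σ ≤ contextSize τ
    contextSize-mono {σ} {τ} σ≼τ =
      length-filter-mono (InContext? σ) (InContext? τ) (λ {g} → InContext-mono σ≼τ g) guards

    ≼-sameSize⇒SameContext : (∀ {g} → IsGuardOf A g → g ∈ guards)
                           → ∀ {σ τ} → σ ≼ τ → contextSize σ ≡ contextSize τ → SameContext A σ τ
    ≼-sameSize⇒SameContext listed {σ} {τ} σ≼τ sameSize g isGuard =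
      mk⇔ (InContext-mono σ≼τ g)
          (length-filter-≡⇒⊇ (InContext? σ) (InContext? τ) (λ {g} → InContext-mono σ≼τ g)
                             sameSize (listed isGuard))

    Linked-≼-sameSize⇒Steady : (∀ {g} → IsGuardOf A g → g ∈ guards)
                             → ∀ {σs} → Linked (_≼_ ∩ (_≡_ on contextSize)) σs → Steady A σs
    Linked-≼-sameSize⇒Steady listed linked =
      Linked⇒All² SameContext-isEquivalence
        (Linked.map (λ (σ≼τ , sameSize) → ≼-sameSize⇒SameContext listed σ≼τ sameSize) linked)

proposition1 : (E : Env) (A : TA E)
    → (guards : List (Guard (TA.nΓ A) (Env.np E)))
    → Unique guards
    → (∀ g → (g ∈ guards) ⇔ IsGuardOf A g)
    → (σ₀ : Config A) (rs : List (Rule (TA.nL A) (TA.nΓ A) (Env.np E)))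
    → IsPath A σ₀ rs
    → Σ (List (List (Config A))) λ blocks
        → IsSteadyDecomposition A σ₀ rs blocks
          × length blocks ≤ suc (length guards)
proposition1 E A guards _ guards⇔ σ₀ rs _ =
  runs path ,
  ( concat-runs path
  , All.map (≢[]⇒NonEmpty A) (runs-≢[] path)
  , All.map (Linked-≼-sameSize⇒Steady A guards listed) (runs-Linked path-≼)
  ) ,
  length-runs≤ (Linked.map (contextSize-mono A guards) path-≼) (All.universal (contextSize≤ A guards) path)
  where
  open RunsOf (contextSize A guards)
  path : List (Config A)
  path = configs A σ₀ rs
  path-≼ : Linked (_≼_ A) path
  path-≼ = configs-≼-Linked A σ₀ rs
  listed : ∀ {g} → IsGuardOf A g → g ∈ guards
  listed {g} = Equivalence.from (guards⇔ g)
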